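{- Let $S$ be a finite binary string ending in $1$ with $VCdim(S)=d$ for an integer $d>0$, and let $S^{([0:-1])}$ denote $S$ with its last symbol removed. If $VCdim(S^{([0:-1])})<d$, then there is an integer $k$ such that $VCdim(S^{([0:-1])}01^k)=d$.
   Context: For a finite binary string $s$ (indexed from $0$), $n(s)=\{i: s_i=1\}$; for a binary string $S$, $\mathfrak{S}=\{n(s): s \text{ a finite contiguous substring of } S\}$; a set $B\subseteq\mathbb{N}$ is shattered if $\{c\cap B: c\in\mathfrak{S}\}$ is the power set of $B$; $VCdim(S)$ is the largest size of a shattered set. $1^k$ denotes a block of $k$ ones and juxtaposition denotes concatenation. -}

module Defs where

open import Data.Bool using (Bool; true; false)
open import Data.Nat using (ℕ; zero; suc; _≤_)
open import Data.List using (List; []; _∷_; _++_; length)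
open import Data.List.Membership.Propositional using (_∈_)
open import Data.List.Relation.Unary.Unique.Propositional using (Unique)
open import Data.Product using (Σ; _×_; ∃)
open import Relation.Binary.PropositionalEquality using (_≡_)

-- Binary strings are lists of booleans (true = 1, false = 0), indexed from 0.
BinStr : Set
BinStr = List Bool

-- bit s i = true  iff  i ∈ n(s)  (i.e. i < |s| and s_i = 1).
bit : BinStr → ℕ → Bool
bit []           _       = false
bit (b ∷ _)      zero    = b
bit (_ ∷ s)      (suc i) = bit s i

Substring : BinStr → BinStr → Set
Substring s S = Σ BinStr λ p → Σ BinStr λ q → S ≡ p ++ (s ++ q)

-- A finite set B ⊆ ℕ (a duplicate-free list) is shattered by S:
-- every subset C of B (given by its characteristic function restricted to B)
-- equals n(s) ∩ B for some substring s of S.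
Shattered : BinStr → List ℕ → Set
Shattered S B =
  (C : ℕ → Bool) → Σ BinStr λ s → Substring s S × ((x : ℕ) → x ∈ B → bit s x ≡ C x)

IsVCdim : BinStr → ℕ → Set
IsVCdim S d =
  (Σ (List ℕ) λ B → Unique B × Shattered S B × length B ≡ d)
  × ((B : List ℕ) → Unique B → Shattered S B → length B ≤ d)

-- Appending one symbol raises the VC dimension by at most one: if S ∷ʳ c shatters B and m is the
-- maximum of B, a substring realising a pattern that contains m reaches position m, so cutting it
-- just before m gives a substring of S realising the pattern on the rest of B.  Hence S' 0 has
-- dimension at most dim S' + 1 ≤ d, and each S' 0 1^(k+1) at most one more than S' 0 1^k.  For
-- k = |S'| + 1 the string S' 0 1^k shatters a d-set: in a d-set shattered by S' 1, replace the
-- maximum by the point |S'| + 1, which falls in the block of ones exactly for the substrings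
-- extended to the end of S'.  So the first k for which S' 0 1^k shatters a d-set has dimension d;
-- it is found by search, shattering being decidable for finite strings.
module Submission where

open import Defs
open import Data.Bool using (Bool; true; false)
open import Data.Nat using (ℕ; _<_)
open import Data.List using (List; []; _∷_; _++_; replicate)
open import Data.Product using (∃)

open import Data.Bool.Properties using () renaming (_≟_ to _≟ᵇ_)
open import Data.Empty using (⊥-elim)
open import Data.List using (length; take; drop; _∷ʳ_)
open import Data.List.Membership.Propositional using (_∈_)
open import Data.List.Properties using (++-assoc; ++-identityʳ; length-++; length-++-≤ˡ; length-take; take++drop≡id; ∷ʳ-injective; ++-conicalˡ)
open import Data.List.Relation.Binary.Subset.Propositional using (_⊆_)
open import Data.List.Relation.Unary.All as All using (All; []; _∷_)
open import Data.List.Relation.Unary.AllPairs using ([]; _∷_)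
open import Data.List.Relation.Unary.Any using (here; there)
open import Data.List.Relation.Unary.Unique.Propositional using (Unique)
open import Data.List.Relation.Unary.Unique.Propositional.Properties using (take⁺)
open import Data.List.Relation.Unary.Unique.DecPropositional Data.Nat._≟_ using (unique?)
open import Data.List.Reverse using (Reverse; reverseView; []; _∶_∶ʳ_)
open import Data.Nat using (zero; suc; _+_; _⊓_; _≤_; _≟_; z≤n; s≤s)
open import Data.Nat.Properties
open import Data.Product using (Σ; _×_; _,_; proj₁; proj₂)
open import Data.Sum using (_⊎_; inj₁; inj₂)
open import Relation.Nullary using (¬_; Dec; yes; no)
open import Relation.Nullary.Decidable using (map′; _×-dec_; _⊎-dec_)
open import Relation.Unary using (Decidable)
open import Relation.Binary.Definitions using (Tri; tri<; tri≈; tri>)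
open import Relation.Binary.PropositionalEquality using (_≡_; _≢_; refl; sym; trans; cong; subst; ≢-sym; module ≡-Reasoning)

AgreeOn : List ℕ → (ℕ → Bool) → (ℕ → Bool) → Set
AgreeOn B f g = ∀ x → x ∈ B → f x ≡ g x

ShattersSetOfSize : BinStr → ℕ → Set
ShattersSetOfSize S d = Σ (List ℕ) λ B → Unique B × Shattered S B × length B ≡ d

_01^_ : BinStr → ℕ → BinStr
S 01^ k = S ++ false ∷ replicate k true

length-∷ʳ : ∀ {A : Set} (xs : List A) x → length (xs ∷ʳ x) ≡ suc (length xs)
length-∷ʳ xs x = trans (length-++ xs) (+-comm (length xs) 1)

take-++ˡ : ∀ {A : Set} m (xs ys : List A) → m ≤ length xs → take m (xs ++ ys) ≡ take m xs
take-++ˡ zero xs ys _ = refl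
take-++ˡ (suc m) (x ∷ xs) ys (s≤s m≤xs) = cong (x ∷_) (take-++ˡ m xs ys m≤xs)

take⊆ : ∀ {A : Set} n {xs : List A} → take n xs ⊆ xs
take⊆ (suc n) {_ ∷ _} (here eq) = here eq
take⊆ (suc n) {_ ∷ _} (there x∈) = there (take⊆ n x∈)

bit-++ˡ : ∀ s u {x} → x < length s → bit (s ++ u) x ≡ bit s x
bit-++ˡ (b ∷ s) u {zero} _ = refl
bit-++ˡ (b ∷ s) u {suc x} (s≤s x<s) = bit-++ˡ s u x<s

bit-++ʳ : ∀ s u y → bit (s ++ u) (length s + y) ≡ bit u y
bit-++ʳ [] u y = refl
bit-++ʳ (b ∷ s) u y = bit-++ʳ s u y

bit≡true⇒<length : ∀ s {x} → bit s x ≡ true → x < length s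
bit≡true⇒<length (b ∷ s) {zero} _ = s≤s z≤n
bit≡true⇒<length (b ∷ s) {suc x} eq = s≤s (bit≡true⇒<length s eq)

bit-≥length : ∀ s {x} → length s ≤ x → bit s x ≡ false
bit-≥length [] _ = refl
bit-≥length (b ∷ s) {suc x} (s≤s s≤x) = bit-≥length s s≤x

bit-take : ∀ m s {x} → x < m → bit (take m s) x ≡ bit s x
bit-take (suc m) [] _ = refl
bit-take (suc m) (b ∷ s) {zero} _ = refl
bit-take (suc m) (b ∷ s) {suc x} (s≤s x<m) = bit-take m s x<m

bit-replicate-true : ∀ k {y} → y < k → bit (replicate k true) y ≡ true
bit-replicate-true (suc k) {zero} _ = refl
bit-replicate-true (suc k) {suc y} (s≤s y<k) = bit-replicate-true k y<k

bit-01^-ones : ∀ t {j k} → j < k → bit (t 01^ k) (length t + suc j) ≡ true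
bit-01^-ones t {j} {k} j<k = trans (bit-++ʳ t (false ∷ replicate k true) (suc j)) (bit-replicate-true k j<k)

update : (ℕ → Bool) → ℕ → Bool → ℕ → Bool
update f m b y with y ≟ m
... | yes _ = b
... | no _ = f y

update-≡ : ∀ f m b → update f m b m ≡ b
update-≡ f m b with m ≟ m
... | yes _ = refl
... | no m≢m = ⊥-elim (m≢m refl)

update-≢ : ∀ f {m} b {y} → y ≢ m → update f m b y ≡ f y
update-≢ f {m} b {y} y≢m with y ≟ m
... | yes y≡m = ⊥-elim (y≢m y≡m)
... | no _ = refl

update-self : ∀ f m y → update f m (f m) y ≡ f y
update-self f m y with y ≟ m
... | yes refl = refl
... | no _ = refl

update-cong : ∀ {B f g} m b → AgreeOn B f g → AgreeOn (m ∷ B) (update f m b) (update g m b)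
update-cong m b f≈g y y∈ with y ≟ m | y∈
... | yes _ | _ = refl
... | no y≢m | here y≡m = ⊥-elim (y≢m y≡m)
... | no _ | there y∈B = f≈g y y∈B

Substring-length : ∀ {s S} → Substring s S → length s ≤ length S
Substring-length {s} (p , q , refl) = begin
  length s             ≤⟨ length-++-≤ˡ s ⟩
  length (s ++ q)      ≤⟨ m≤n+m _ (length p) ⟩
  length p + length (s ++ q) ≡⟨ length-++ p ⟨
  length (p ++ s ++ q) ∎
  where open ≤-Reasoning

Substring-++ʳ : ∀ {s S} R → Substring s S → Substring s (S ++ R)
Substring-++ʳ {s} R (p , q , refl) =
  p , q ++ R , trans (++-assoc p (s ++ q) R) (cong (p ++_) (++-assoc s q R))

length-≤-∷ʳ : ∀ (r q : BinStr) {t c} → r ++ q ≡ t ∷ʳ c → length r ≤ suc (length t)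
length-≤-∷ʳ r q {t} {c} eq = begin
  length r        ≤⟨ length-++-≤ˡ r ⟩
  length (r ++ q) ≡⟨ cong length eq ⟩
  length (t ∷ʳ c) ≡⟨ length-∷ʳ t c ⟩
  suc (length t)  ∎
  where open ≤-Reasoning

Substring-∷ʳ⇒suffix : ∀ {r X c} → Substring r (X ∷ʳ c) →
  Σ BinStr λ a → Σ BinStr λ t → Σ BinStr λ q → X ≡ a ++ t × r ++ q ≡ t ∷ʳ c
Substring-∷ʳ⇒suffix {r} {X} {c} (p , q , eq) = split (reverseView (r ++ q)) refl
  where
  split : ∀ {w} → Reverse w → r ++ q ≡ w →
    Σ BinStr λ a → Σ BinStr λ t → Σ BinStr λ q′ → X ≡ a ++ t × r ++ q′ ≡ t ∷ʳ c
  split [] r++q≡[] rewrite ++-conicalˡ r q r++q≡[] = X , [] , c ∷ [] , sym (++-identityʳ X) , refl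
  split (w ∶ _ ∶ʳ z) r++q≡w∷ʳz
    with ∷ʳ-injective X (p ++ w) (trans eq (trans (cong (p ++_) r++q≡w∷ʳz) (sym (++-assoc p w (z ∷ [])))))
  ... | X≡p++w , refl = p , w , q , X≡p++w , r++q≡w∷ʳz

take-Substring-∷ʳ : ∀ {r X c} m → Substring r (X ∷ʳ c) → m < length r → Substring (take m r) X
take-Substring-∷ʳ {r} {X} {c} m sub m<r with Substring-∷ʳ⇒suffix sub
... | a , t , q , refl , r++q≡t∷ʳc = a , drop m t , a++t-split
  where
  open ≡-Reasoning
  m≤t : m ≤ length t
  m≤t = ≤-pred (≤-trans m<r (length-≤-∷ʳ r q r++q≡t∷ʳc))
  take-r≡take-t : take m r ≡ take m t
  take-r≡take-t = begin
    take m r          ≡⟨ take-++ˡ m r q (<⇒≤ m<r) ⟨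
    take m (r ++ q)   ≡⟨ cong (take m) r++q≡t∷ʳc ⟩
    take m (t ∷ʳ c)   ≡⟨ take-++ˡ m t (c ∷ []) m≤t ⟩
    take m t          ∎
  a++t-split : a ++ t ≡ a ++ take m r ++ drop m t
  a++t-split = begin
    a ++ t                     ≡⟨ cong (a ++_) (take++drop≡id m t) ⟨
    a ++ take m t ++ drop m t  ≡⟨ cong (λ u → a ++ u ++ drop m t) take-r≡take-t ⟨
    a ++ take m r ++ drop m t  ∎

Shattered-⊆ : ∀ {S B B′} → B′ ⊆ B → Shattered S B → Shattered S B′
Shattered-⊆ B′⊆B sh C with sh C
... | s , sub , agree = s , sub , λ x x∈ → agree x (B′⊆B x∈)

Shattered⇒<length : ∀ {S B} → Shattered S B → ∀ {x} → x ∈ B → x < length S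
Shattered⇒<length sh {x} x∈ with sh (λ _ → true)
... | s , sub , agree = <-≤-trans (bit≡true⇒<length s (agree x x∈)) (Substring-length sub)

record MaxSplit (B : List ℕ) : Set where
  field
    top : ℕ
    rest : List ℕ
    top∈ : top ∈ B
    rest⊆ : rest ⊆ B
    rest<top : All (_< top) rest
    rest-unique : Unique rest
    length-rest : suc (length rest) ≡ length B

MaxSplit-∷ : ∀ x {B} → All (x ≢_) B → MaxSplit B → MaxSplit (x ∷ B)
MaxSplit-∷ x {B} x∉B sp = extend (<-cmp x top)
  where
  open MaxSplit sp
  extend : Tri (x < top) (x ≡ top) (top < x) → MaxSplit (x ∷ B)
  extend (tri< x<top _ _) = record
    { top = top ; rest = x ∷ rest ; top∈ = there top∈
    ; rest⊆ = λ { (here refl) → here refl ; (there z∈) → there (rest⊆ z∈) }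
    ; rest<top = x<top ∷ rest<top
    ; rest-unique = All.tabulate (λ z∈ → All.lookup x∉B (rest⊆ z∈)) ∷ rest-unique
    ; length-rest = cong suc length-rest }
  extend (tri≈ _ x≡top _) = ⊥-elim (All.lookup x∉B top∈ x≡top)
  extend (tri> _ _ top<x) = record
    { top = x ; rest = top ∷ rest ; top∈ = here refl
    ; rest⊆ = λ { (here refl) → there top∈ ; (there z∈) → there (rest⊆ z∈) }
    ; rest<top = top<x ∷ All.map (λ z<top → <-trans z<top top<x) rest<top
    ; rest-unique = All.map (λ z<top → ≢-sym (<⇒≢ z<top)) rest<top ∷ rest-unique
    ; length-rest = cong suc length-rest }

splitMax : ∀ x B → Unique (x ∷ B) → MaxSplit (x ∷ B)
splitMax x [] _ = record
  { top = x ; rest = [] ; top∈ = here refl ; rest⊆ = λ () ; rest<top = []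
  ; rest-unique = [] ; length-rest = refl }
splitMax x (y ∷ B) (x∉ ∷ u) = MaxSplit-∷ x x∉ (splitMax y B u)

module _ {S B} (sh : Shattered S B) (sp : MaxSplit B) where
  open MaxSplit sp

  top<length : top < length S
  top<length = Shattered⇒<length sh top∈

  realise-with-top : (C : ℕ → Bool) →
    Σ BinStr λ r → Substring r S × top < length r × AgreeOn rest (bit r) C
  realise-with-top C with sh (update C top true)
  ... | r , sub , agree = r , sub , bit≡true⇒<length r top∈r , agree-rest
    where
    top∈r : bit r top ≡ true
    top∈r = trans (agree top top∈) (update-≡ C top true)
    agree-rest : AgreeOn rest (bit r) C
    agree-rest x x∈ = trans (agree x (rest⊆ x∈)) (update-≢ C true (<⇒≢ (All.lookup rest<top x∈)))

Shattered-init : ∀ {X c B} → Shattered (X ∷ʳ c) B → (sp : MaxSplit B) → Shattered X (MaxSplit.rest sp)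
Shattered-init sh sp C with realise-with-top sh sp C
... | r , sub , top<r , agree =
  take top r , take-Substring-∷ʳ top sub top<r ,
  λ x x∈ → trans (bit-take top r (All.lookup rest<top x∈)) (agree x x∈)
  where open MaxSplit sp

ShattersSetOfSize-init : ∀ {X c n} → ShattersSetOfSize (X ∷ʳ c) (suc n) → ShattersSetOfSize X n
ShattersSetOfSize-init (x ∷ B , u , sh , len) =
  rest , rest-unique , Shattered-init sh sp , suc-injective (trans length-rest len)
  where
  sp = splitMax x B u
  open MaxSplit sp

Substring-∷ʳ⇒01^ : ∀ {r X} → Substring r (X ∷ʳ true) →
  Σ BinStr λ s → Substring s (X 01^ suc (length X)) × bit s (suc (length X)) ≡ true
    × (∀ {x} → suc x < length r → bit s x ≡ bit r x)
Substring-∷ʳ⇒01^ {r} sub with Substring-∷ʳ⇒suffix sub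
... | a , t , q , refl , r++q≡t∷ʳ1 = t 01^ K , (a , [] , suffix) , new-in-ones , agree-below
  where
  K = suc (length (a ++ t))
  suffix : (a ++ t) 01^ K ≡ a ++ (t 01^ K ++ [])
  suffix = trans (++-assoc a t _) (cong (a ++_) (sym (++-identityʳ (t 01^ K))))
  new≡ : length t + suc (length a) ≡ K
  new≡ = trans (+-suc (length t) (length a)) (cong suc (trans (+-comm (length t) (length a)) (sym (length-++ a))))
  new-in-ones : bit (t 01^ K) K ≡ true
  new-in-ones = subst (λ y → bit (t 01^ K) y ≡ true) new≡ (bit-01^-ones t (s≤s (length-++-≤ˡ a)))
  agree-below : ∀ {x} → suc x < length r → bit (t 01^ K) x ≡ bit r x
  agree-below {x} sx<r = begin
    bit (t 01^ K) x    ≡⟨ bit-++ˡ t _ x<t ⟩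
    bit t x            ≡⟨ bit-++ˡ t (true ∷ []) x<t ⟨
    bit (t ∷ʳ true) x  ≡⟨ cong (λ u → bit u x) r++q≡t∷ʳ1 ⟨
    bit (r ++ q) x     ≡⟨ bit-++ˡ r q (<⇒≤ sx<r) ⟩
    bit r x            ∎
    where
    open ≡-Reasoning
    x<t : x < length t
    x<t = ≤-pred (≤-trans sx<r (length-≤-∷ʳ r q r++q≡t∷ʳ1))

Shattered-01^ : ∀ {X B} → Shattered (X ∷ʳ true) B → (sp : MaxSplit B) →
  Shattered (X 01^ suc (length X)) (suc (length X) ∷ MaxSplit.rest sp)
Shattered-01^ {X} sh sp C with realise-with-top sh sp C | C (suc (length X)) in C-new
... | r , sub , top<r , agree | false =
  take top r , Substring-++ʳ _ (take-Substring-∷ʳ top sub top<r) , agree-new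
  where
  open MaxSplit sp
  take-top-r≤new : length (take top r) ≤ suc (length X)
  take-top-r≤new = begin
    length (take top r) ≡⟨ length-take top r ⟩
    top ⊓ length r      ≤⟨ m⊓n≤m top (length r) ⟩
    top                 ≤⟨ <⇒≤ (top<length sh sp) ⟩
    length (X ∷ʳ true)  ≡⟨ length-∷ʳ X true ⟩
    suc (length X)      ∎
    where open ≤-Reasoning
  agree-new : AgreeOn (suc (length X) ∷ rest) (bit (take top r)) C
  agree-new _ (here refl) = trans (bit-≥length (take top r) take-top-r≤new) (sym C-new)
  agree-new x (there x∈) = trans (bit-take top r (All.lookup rest<top x∈)) (agree x x∈)
... | r , sub , top<r , agree | true with Substring-∷ʳ⇒01^ sub
... | s , sub′ , new-in-ones , agree-below = s , sub′ , agree-new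
  where
  open MaxSplit sp
  agree-new : AgreeOn (suc (length X) ∷ rest) (bit s) C
  agree-new _ (here refl) = trans new-in-ones (sym C-new)
  agree-new x (there x∈) = trans (agree-below (≤-<-trans (All.lookup rest<top x∈) top<r)) (agree x x∈)

ShattersSetOfSize-01^ : ∀ {X n} → ShattersSetOfSize (X ∷ʳ true) (suc n) →
  ShattersSetOfSize (X 01^ suc (length X)) (suc n)
ShattersSetOfSize-01^ {X} (x ∷ B , u , sh , len) =
  suc (length X) ∷ rest , new∉rest ∷ rest-unique , Shattered-01^ sh sp , trans length-rest len
  where
  sp = splitMax x B u
  open MaxSplit sp
  top<new : top < suc (length X)
  top<new = <-≤-trans (top<length sh sp) (≤-reflexive (length-∷ʳ X true))
  new∉rest : All (suc (length X) ≢_) rest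
  new∉rest = All.map (λ z<top → ≢-sym (<⇒≢ (<-trans z<top top<new))) rest<top

IsVCdim-intro : ∀ {S d} → ShattersSetOfSize S d → ¬ ShattersSetOfSize S (suc d) → IsVCdim S d
IsVCdim-intro {S} {d} has-d no-larger = has-d , bounded
  where
  bounded : (B : List ℕ) → Unique B → Shattered S B → length B ≤ d
  bounded B u sh with length B ≤? d
  ... | yes B≤d = B≤d
  ... | no B≰d = ⊥-elim (no-larger
    (take (suc d) B , take⁺ (suc d) u , Shattered-⊆ (take⊆ (suc d)) sh ,
     trans (length-take (suc d) B) (m≤n⇒m⊓n≡m (≰⇒> B≰d))))

crossing : ∀ {Q : ℕ → Set} → Decidable Q → ∀ k → Q k → Q 0 ⊎ ∃ λ j → ¬ Q j × Q (suc j)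
crossing Q? zero Q0 = inj₁ Q0
crossing Q? (suc k) Qsk with Q? k
... | yes Qk = crossing Q? k Qk
... | no ¬Qk = inj₂ (k , ¬Qk , Qsk)

agree? : ∀ B f g → Dec (AgreeOn B f g)
agree? B f g = map′ (λ all x → All.lookup all) (λ agree → All.tabulate (agree _)) (All.all? (λ x → f x ≟ᵇ g x) B)

∀-pattern? : ∀ B {R : (ℕ → Bool) → Set} → (∀ {f g} → AgreeOn B f g → R f → R g) →
  (∀ C → Dec (R C)) → Dec (∀ C → R C)
∀-pattern? [] resp R? with R? (λ _ → false)
... | yes R-false = yes λ C → resp (λ _ ()) R-false
... | no ¬R-false = no λ R-all → ¬R-false (R-all _)
∀-pattern? (m ∷ B) {R} resp R? =
  map′ (λ both C → resp (λ y _ → update-self C m y) (pick C (C m) (both C)))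
       (λ R-all C → R-all _ , R-all _)
       (∀-pattern? B resp-both λ C → R? _ ×-dec R? _)
  where
  Both : (ℕ → Bool) → Set
  Both C = R (update C m false) × R (update C m true)
  resp-both : ∀ {f g} → AgreeOn B f g → Both f → Both g
  resp-both f≈g (R₀ , R₁) = resp (update-cong m false f≈g) R₀ , resp (update-cong m true f≈g) R₁
  pick : ∀ C b → Both C → R (update C m b)
  pick C false = proj₁
  pick C true = proj₂

Prefix : BinStr → BinStr → Set
Prefix s S = Σ BinStr λ q → S ≡ s ++ q

∃-prefix? : ∀ {Q : BinStr → Set} → Decidable Q → ∀ S → Dec (∃ λ s → Prefix s S × Q s)
∃-prefix? {Q} Q? [] = map′ (λ Q[] → [] , ([] , refl) , Q[]) from (Q? [])
  where
  from : (∃ λ s → Prefix s [] × Q s) → Q []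
  from ([] , _ , Q[]) = Q[]
  from (_ ∷ _ , (_ , ()) , _)
∃-prefix? {Q} Q? (c ∷ S) = map′ to from (Q? [] ⊎-dec ∃-prefix? (λ s → Q? (c ∷ s)) S)
  where
  to : Q [] ⊎ (∃ λ s → Prefix s S × Q (c ∷ s)) → ∃ λ s → Prefix s (c ∷ S) × Q s
  to (inj₁ Q[]) = [] , (c ∷ S , refl) , Q[]
  to (inj₂ (s , (q , refl) , Qcs)) = c ∷ s , (q , refl) , Qcs
  from : (∃ λ s → Prefix s (c ∷ S) × Q s) → Q [] ⊎ (∃ λ s → Prefix s S × Q (c ∷ s))
  from ([] , _ , Q[]) = inj₁ Q[]
  from (_ ∷ s , (q , refl) , Qcs) = inj₂ (s , (q , refl) , Qcs)

∃-substring? : ∀ {Q : BinStr → Set} → Decidable Q → ∀ S → Dec (∃ λ s → Substring s S × Q s)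
∃-substring? {Q} Q? [] = map′ to from (∃-prefix? Q? [])
  where
  to : (∃ λ s → Prefix s [] × Q s) → ∃ λ s → Substring s [] × Q s
  to (s , (q , e) , Qs) = s , ([] , q , e) , Qs
  from : (∃ λ s → Substring s [] × Q s) → ∃ λ s → Prefix s [] × Q s
  from (s , ([] , q , e) , Qs) = s , (q , e) , Qs
  from (_ , (_ ∷ _ , _ , ()) , _)
∃-substring? {Q} Q? (c ∷ S) = map′ to from (∃-prefix? Q? (c ∷ S) ⊎-dec ∃-substring? Q? S)
  where
  to : (∃ λ s → Prefix s (c ∷ S) × Q s) ⊎ (∃ λ s → Substring s S × Q s) → ∃ λ s → Substring s (c ∷ S) × Q s
  to (inj₁ (s , (q , e) , Qs)) = s , ([] , q , e) , Qs
  to (inj₂ (s , (p , q , e) , Qs)) = s , (c ∷ p , q , cong (c ∷_) e) , Qs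
  from : (∃ λ s → Substring s (c ∷ S) × Q s) → (∃ λ s → Prefix s (c ∷ S) × Q s) ⊎ (∃ λ s → Substring s S × Q s)
  from (s , ([] , q , e) , Qs) = inj₁ (s , (q , e) , Qs)
  from (s , (_ ∷ p , q , refl) , Qs) = inj₂ (s , (p , q , refl) , Qs)

shattered? : ∀ S B → Dec (Shattered S B)
shattered? S B = ∀-pattern? B resp (λ C → ∃-substring? (λ s → agree? B (bit s) C) S)
  where
  resp : ∀ {f g} → AgreeOn B f g → (∃ λ s → Substring s S × AgreeOn B (bit s) f) →
    ∃ λ s → Substring s S × AgreeOn B (bit s) g
  resp f≈g (s , sub , agree) = s , sub , λ x x∈ → trans (agree x x∈) (f≈g x x∈)

∃-bounded-list? : ∀ {Q : List ℕ → Set} → Decidable Q → ∀ L n →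
  Dec (∃ λ B → All (_< L) B × length B ≡ n × Q B)
∃-bounded-list? {Q} Q? L zero = map′ (λ Q[] → [] , [] , refl , Q[]) from (Q? [])
  where
  from : (∃ λ B → All (_< L) B × length B ≡ 0 × Q B) → Q []
  from ([] , _ , _ , Q[]) = Q[]
∃-bounded-list? {Q} Q? L (suc n) = map′ to from (anyUpTo? (λ x → ∃-bounded-list? (λ B → Q? (x ∷ B)) L n) L)
  where
  Tail : ℕ → Set
  Tail x = ∃ λ B → All (_< L) B × length B ≡ n × Q (x ∷ B)
  to : (∃ λ x → x < L × Tail x) → ∃ λ B → All (_< L) B × length B ≡ suc n × Q B
  to (x , x<L , B , B<L , len , Q-xB) = x ∷ B , x<L ∷ B<L , cong suc len , Q-xB
  from : (∃ λ B → All (_< L) B × length B ≡ suc n × Q B) → ∃ λ x → x < L × Tail x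
  from (x ∷ B , x<L ∷ B<L , len , Q-xB) = x , x<L , B , B<L , suc-injective len , Q-xB

ShattersSetOfSize? : ∀ S d → Dec (ShattersSetOfSize S d)
ShattersSetOfSize? S d = map′ to from (∃-bounded-list? (λ B → unique? B ×-dec shattered? S B) (length S) d)
  where
  to : (∃ λ B → All (_< length S) B × length B ≡ d × Unique B × Shattered S B) → ShattersSetOfSize S d
  to (B , _ , len , u , sh) = B , u , sh , len
  from : ShattersSetOfSize S d → ∃ λ B → All (_< length S) B × length B ≡ d × Unique B × Shattered S B
  from (B , u , sh , len) = B , All.tabulate (Shattered⇒<length sh) , len , u , sh

01^-suc : ∀ X j → X 01^ suc j ≡ (X 01^ j) ∷ʳ true
01^-suc X j = begin
  X ++ false ∷ replicate (suc j) true      ≡⟨ cong (λ u → X ++ false ∷ u) (replicate-∷ʳ j) ⟨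
  X ++ false ∷ replicate j true ∷ʳ true   ≡⟨ ++-assoc X (false ∷ replicate j true) (true ∷ []) ⟨
  (X 01^ j) ∷ʳ true                       ∎
  where
  open ≡-Reasoning
  replicate-∷ʳ : ∀ j → replicate j true ∷ʳ true ≡ replicate (suc j) true
  replicate-∷ʳ zero = refl
  replicate-∷ʳ (suc j) = cong (true ∷_) (replicate-∷ʳ j)

proposition13 : (S' : BinStr) (d : ℕ) → 0 < d →
    IsVCdim (S' ++ true ∷ []) d →
    (e : ℕ) → IsVCdim S' e → e < d →
    ∃ λ k → IsVCdim (S' ++ (false ∷ replicate k true)) d
proposition13 S' (suc n) _ (has-d , _) e (_ , e-max) e<d
  with crossing (λ k → ShattersSetOfSize? (S' 01^ k) (suc n)) (suc (length S')) (ShattersSetOfSize-01^ has-d)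
... | inj₁ at-0 = 0 , IsVCdim-intro at-0 λ larger → <⇒≱ e<d (at-most-e (ShattersSetOfSize-init larger))
  where
  at-most-e : ShattersSetOfSize S' (suc n) → suc n ≤ e
  at-most-e (B , u , sh , len) = subst (_≤ e) len (e-max B u sh)
... | inj₂ (j , ¬at-j , at-suc-j) = suc j , IsVCdim-intro at-suc-j λ larger →
  ¬at-j (ShattersSetOfSize-init (subst (λ X → ShattersSetOfSize X (suc (suc n))) (01^-suc S' j) larger))
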